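{- For all contractive $\mu$-types $A, B$: $A \simeq_{\vec\mu} B$ if and only if for every $k\in\mathbb{N}$, $T(A)|_k \simeq_{\mathfrak{T}} T(B)|_k$.
   Context: Types are contractive $\mu$-types built from datatype/type variables and constants $a$, the constructors $@$ (type application) and $\supset$ (function type), the connector $\oplus$ (union, modulo associativity; $\bigoplus_{i\in1..n}A_i$ denotes a maximal union, i.e. each $A_i$ is not itself a union), and the recursion binder $\mu V.A$. $\simeq_{\vec\mu}$ is the coinductively defined (greatest-fixed-point) relation on $\mu$-types generated by the rules: $a\simeq_{\vec\mu} a$; $D@A\simeq_{\vec\mu}D'@A'$ if $D\simeq_{\vec\mu}D'$ and $A\simeq_{\vec\mu}A'$; $A\supset B\simeq_{\vec\mu}A'\supset B'$ if $A\simeq_{\vec\mu}A'$ and $B\simeq_{\vec\mu}B'$; $\mathscr{C}[\mu V.A]\simeq_{\vec\mu}B$ if $\mathscr{C}[\{\mu V.A/V\}A]\simeq_{\vec\mu}B$; $A\simeq_{\vec\mu}\mathscr{D}[\mu W.B]$ if $A\simeq_{\vec\mu}\mathscr{D}[\{\mu W.B/W\}B]$ and $A$ is not of the form $\mathscr{C}[\mu V.C]$; and $\bigoplus_{i\in1..n}A_i\simeq_{\vec\mu}\bigoplus_{j\in1..m}B_j$ (with $n+m>2$ and all $A_i,B_j$ neither $\mu$-types nor unions) if there are functions $f:1..n\to1..m$ and $g:1..m\to1..n$ with $A_i\simeq_{\vec\mu}B_{f(i)}$ and $A_{g(j)}\simeq_{\vec\mu}B_j$ for all $i,j$. Here $\mathscr{C},\mathscr{D}$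 are contexts $A_1\oplus\dots\oplus A_{i-1}\oplus\Box\oplus A_{i+1}\oplus\dots\oplus A_n$ with no $A_j$ a union and no $A_l$ ($l<i$) a $\mu$-type, i.e. the hole marks the first $\mu$ in a maximal union. $T(A)$ is the possibly infinite regular tree (over the symbols $a$, $@$, $\supset$, binary $\oplus$) obtained by completely unfolding $A$: $T(a)=a$, $T(A_1\star A_2)=T(A_1)\star T(A_2)$ for $\star\in\{@,\supset,\oplus\}$, and $T(\mu V.A)=T(\{\mu V.A/V\}A)$. The truncation $\mathsf{A}|_k$ of a tree at depth $k$ is: $\mathsf{A}|_0=\circ$ (a distinguished constant); $a|_{k+1}=a$; $(\mathsf{A}_1\star\mathsf{A}_2)|_{k+1}=\mathsf{A}_1|_k\star\mathsf{A}_2|_k$ for $\star\in\{@,\supset\}$; $(\mathsf{A}_1\oplus\mathsf{A}_2)|_{k+1}=\mathsf{A}_1|_{k+1}\oplus\mathsf{A}_2|_{k+1}$ (unions do not count for depth). $\simeq_{\mathfrak{T}}$ is the coinductive equivalence on such trees given by the same rules as $\simeq_{\vec\mu}$ for constants, $@$, $\supset$ and unions (with $f$, $g$), but without the two $\mu$-unfolding rules. -}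

module Defs where

open import Data.Nat using (ℕ; zero; suc; _+_; _<_)
open import Data.Fin using (Fin; zero; suc)
open import Data.List using (List; []; _∷_; _++_; [_]; length; lookup)
open import Data.List.Relation.Unary.All using (All)
open import Data.Unit using (⊤)
open import Data.Product using (_×_; Σ)
open import Data.Bool using (Bool; true; false)
open import Data.Empty using (⊥)
open import Relation.Binary.PropositionalEquality using (_≡_; _≢_)

-- Constants a and free (datatype/type) variables are both represented
-- by `con a` (a : ℕ a name); bound variables are `var i`.

infixr 6 _⊕_
infixr 7 _⊃_
infixl 8 _＠_

data Ty (n : ℕ) : Set where
  var  : Fin n → Ty n
  con  : ℕ → Ty n
  _＠_ : Ty n → Ty n → Ty n
  _⊃_  : Ty n → Ty n → Ty n
  _⊕_  : Ty n → Ty n → Ty n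
  μ_   : Ty (suc n) → Ty n

ext : ∀ {n m} → (Fin n → Fin m) → Fin (suc n) → Fin (suc m)
ext ρ zero    = zero
ext ρ (suc i) = suc (ρ i)

rename : ∀ {n m} → (Fin n → Fin m) → Ty n → Ty m
rename ρ (var i)  = var (ρ i)
rename ρ (con a)  = con a
rename ρ (A ＠ B) = rename ρ A ＠ rename ρ B
rename ρ (A ⊃ B)  = rename ρ A ⊃ rename ρ B
rename ρ (A ⊕ B)  = rename ρ A ⊕ rename ρ B
rename ρ (μ A)    = μ rename (ext ρ) A

exts : ∀ {n m} → (Fin n → Ty m) → Fin (suc n) → Ty (suc m)
exts σ zero    = var zero
exts σ (suc i) = rename suc (σ i)

subst : ∀ {n m} → (Fin n → Ty m) → Ty n → Ty m
subst σ (var i)  = σ i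
subst σ (con a)  = con a
subst σ (A ＠ B) = subst σ A ＠ subst σ B
subst σ (A ⊃ B)  = subst σ A ⊃ subst σ B
subst σ (A ⊕ B)  = subst σ A ⊕ subst σ B
subst σ (μ A)    = μ subst (exts σ) A

_[_]₀ : ∀ {n} → Ty (suc n) → Ty n → Ty n
A [ B ]₀ = subst σ A
  where
  σ : Fin (suc _) → Ty _
  σ zero    = B
  σ (suc i) = var i

unfoldμ : ∀ {n} → Ty (suc n) → Ty n
unfoldμ A = A [ μ A ]₀

Guarded : ∀ {n} → Fin n → Ty n → Set
Guarded i (var j)  = i ≢ j
Guarded i (con a)  = ⊤
Guarded i (A ＠ B) = ⊤
Guarded i (A ⊃ B)  = ⊤
Guarded i (A ⊕ B)  = Guarded i A × Guarded i B
Guarded i (μ A)    = Guarded (suc i) A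

data Contractive {n : ℕ} : Ty n → Set where
  var : ∀ {i} → Contractive (var i)
  con : ∀ {a} → Contractive (con a)
  app : ∀ {A B} → Contractive A → Contractive B → Contractive (A ＠ B)
  fun : ∀ {A B} → Contractive A → Contractive B → Contractive (A ⊃ B)
  uni : ∀ {A B} → Contractive A → Contractive B → Contractive (A ⊕ B)
  rec : ∀ {A} → Guarded zero A → Contractive A → Contractive (μ A)

-- Maximal unions (modulo associativity): the list of components.

flat : ∀ {n} → Ty n → List (Ty n)
flat (A ⊕ B) = flat A ++ flat B
flat (var i)  = [ var i ]
flat (con a)  = [ con a ]
flat (A ＠ B) = [ A ＠ B ]
flat (A ⊃ B)  = [ A ⊃ B ]
flat (μ A)    = [ μ A ]

NotMu : ∀ {n} → Ty n → Set
NotMu (μ A) = ⊥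
NotMu _     = ⊤

⨁ : ∀ {n} → Ty n → List (Ty n) → Ty n
⨁ x []       = x
⨁ x (y ∷ ys) = x ⊕ ⨁ y ys

plug : ∀ {n} → List (Ty n) → Ty n → List (Ty n) → Ty n
plug []       U post = ⨁ U post
plug (x ∷ xs) U post = ⨁ x (xs ++ U ∷ post)


data StepMu (R : Ty 0 → Ty 0 → Set) : Ty 0 → Ty 0 → Set where
  con  : ∀ {a} → StepMu R (con a) (con a)
  app  : ∀ {D D' A A'} → R D D' → R A A' → StepMu R (D ＠ A) (D' ＠ A')
  fun  : ∀ {A A' B B'} → R A A' → R B B' → StepMu R (A ⊃ B) (A' ⊃ B')
  -- C[μV.A] ≃ B  if  C[{μV.A/V}A] ≃ B   (hole = first μ of the maximal union)
  μL   : ∀ {A B} pre C post →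
         flat A ≡ pre ++ (μ C) ∷ post → All NotMu pre →
         R (plug pre (unfoldμ C) post) B → StepMu R A B
  -- A ≃ D[μW.B]  if  A ≃ D[{μW.B/W}B]  and A is not of the form C[μV.C]
  μR   : ∀ {A B} pre C post →
         All NotMu (flat A) →
         flat B ≡ pre ++ (μ C) ∷ post → All NotMu pre →
         R A (plug pre (unfoldμ C) post) → StepMu R A B
  uni  : ∀ {A B} →
         2 < length (flat A) + length (flat B) →
         All NotMu (flat A) → All NotMu (flat B) →
         (f : Fin (length (flat A)) → Fin (length (flat B))) →
         (∀ i → R (lookup (flat A) i) (lookup (flat B) (f i))) →
         (g : Fin (length (flat B)) → Fin (length (flat A))) →
         (∀ j → R (lookup (flat A) (g j)) (lookup (flat B) j)) →
         StepMu R A B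

-- ≃_μ is the greatest fixed point of StepMu: the union of all
-- post-fixed points (bisimulations) R ⊆ StepMu R.
infix 4 _≃μ_
_≃μ_ : Ty 0 → Ty 0 → Set₁
A ≃μ B = Σ (Ty 0 → Ty 0 → Set) λ R →
           R A B × (∀ {X Y} → R X Y → StepMu R X Y)

-- Possibly infinite trees over a, @, ⊃, binary ⊕, represented as
-- labelling functions on positions (paths; false = left, true = right).

data Label : Set where
  leaf : ℕ → Label
  app  : Label
  fun  : Label
  uni  : Label

Tree : Set
Tree = List Bool → Label

child : Tree → Bool → Tree
child t b p = t (b ∷ p)

size : ∀ {n} → Ty n → ℕ
size (var i)  = 1
size (con a)  = 1
size (A ＠ B) = suc (size A + size B)
size (A ⊃ B)  = suc (size A + size B)
size (A ⊕ B)  = suc (size A + size B)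
size (μ A)    = suc (size A)

-- The μ-case is computed with a fuel bound
-- (size of the type) on the number of consecutive head unfoldings;
-- for contractive closed types this bound is never exhausted (the
-- `leaf 0` clause below is unreachable for them).
labelAt : ℕ → Ty 0 → List Bool → Label
labelAt f (con a) p              = leaf a
labelAt f (A ＠ B) []            = app
labelAt f (A ＠ B) (false ∷ p)   = labelAt (size A) A p
labelAt f (A ＠ B) (true ∷ p)    = labelAt (size B) B p
labelAt f (A ⊃ B) []             = fun
labelAt f (A ⊃ B) (false ∷ p)    = labelAt (size A) A p
labelAt f (A ⊃ B) (true ∷ p)     = labelAt (size B) B p
labelAt f (A ⊕ B) []             = uni
labelAt f (A ⊕ B) (false ∷ p)    = labelAt (size A) A p
labelAt f (A ⊕ B) (true ∷ p)     = labelAt (size B) B p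
labelAt zero (μ A) p             = leaf 0
labelAt (suc f) (μ A) p          = labelAt f (unfoldμ A) p

T : Ty 0 → Tree
T A = labelAt (size A) A

-- Finite trees (truncations), with the distinguished constant ∘

infixr 6 _⊕ᶠ_

data FTree : Set where
  ∘     : FTree
  leaf  : ℕ → FTree
  _＠ᶠ_ : FTree → FTree → FTree
  _⊃ᶠ_  : FTree → FTree → FTree
  _⊕ᶠ_  : FTree → FTree → FTree

-- Truncation  𝖠|ₖ , as the (functional) graph of its defining equations:
-- t ∣ k ↦ u  means  t|ₖ = u.
infix 4 _∣_↦_
data _∣_↦_ : Tree → ℕ → FTree → Set where
  zero : ∀ {t} → t ∣ 0 ↦ ∘
  leaf : ∀ {t k a} → t [] ≡ leaf a → t ∣ suc k ↦ leaf a
  app  : ∀ {t k x' y'} → t [] ≡ app →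
         child t false ∣ k ↦ x' → child t true ∣ k ↦ y' → t ∣ suc k ↦ (x' ＠ᶠ y')
  fun  : ∀ {t k x' y'} → t [] ≡ fun →
         child t false ∣ k ↦ x' → child t true ∣ k ↦ y' → t ∣ suc k ↦ (x' ⊃ᶠ y')
  uni  : ∀ {t k x' y'} → t [] ≡ uni →
         child t false ∣ suc k ↦ x' → child t true ∣ suc k ↦ y' → t ∣ suc k ↦ (x' ⊕ᶠ y')

flatᶠ : FTree → List FTree
flatᶠ (t ⊕ᶠ u) = flatᶠ t ++ flatᶠ u
flatᶠ ∘        = [ ∘ ]
flatᶠ (leaf a) = [ leaf a ]
flatᶠ (t ＠ᶠ u) = [ t ＠ᶠ u ]
flatᶠ (t ⊃ᶠ u) = [ t ⊃ᶠ u ]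

data StepT (R : FTree → FTree → Set) : FTree → FTree → Set where
  circ : StepT R ∘ ∘
  con  : ∀ {a} → StepT R (leaf a) (leaf a)
  app  : ∀ {d d' a a'} → R d d' → R a a' → StepT R (d ＠ᶠ a) (d' ＠ᶠ a')
  fun  : ∀ {a a' b b'} → R a a' → R b b' → StepT R (a ⊃ᶠ b) (a' ⊃ᶠ b')
  uni  : ∀ {t u} →
         2 < length (flatᶠ t) + length (flatᶠ u) →
         (f : Fin (length (flatᶠ t)) → Fin (length (flatᶠ u))) →
         (∀ i → R (lookup (flatᶠ t) i) (lookup (flatᶠ u) (f i))) →
         (g : Fin (length (flatᶠ u)) → Fin (length (flatᶠ t))) →
         (∀ j → R (lookup (flatᶠ t) (g j)) (lookup (flatᶠ u) j)) →
         StepT R t u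

infix 4 _≃𝔗_
_≃𝔗_ : FTree → FTree → Set₁
t ≃𝔗 u = Σ (FTree → FTree → Set) λ R →
           R t u × (∀ {x y} → R x y → StepT R x y)

module Submission where

-- Both sides are compared with an inductive approximation Approx k X Y
-- ("X and Y agree up to depth k"): the normal forms of X and Y -- the
-- atoms a, D@A, A⊃B forming the maximal union at the root of T(X), found
-- by unfolding head μ's -- are similar, and corresponding atoms have the
-- same constructor and subterms agreeing up to depth k - 1.
--
--  (1) trunc k X computes T(X)|ₖ, and Approx k X Y holds exactly when the
--      depth-k truncations are ≃𝔗-equivalent (tree-bisim⇒Approx, Approx⇒≃𝔗).
--  (2) Soundness: a ≃μ-bisimulation relates only types agreeing at every
--      depth (bisim⇒Approx), by induction on the head weight, which the
--      unfolding rules μL/μR and the union rule decrease.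
--  (3) Completeness: the types reachable from A and B lie in a finite
--      closure L.  The approximations decrease with k, so on L they become
--      stationary at some depth J, and agreement at depth J + 2 between
--      types with components in L is a ≃μ-bisimulation (Completeness).

open import Defs
open import Data.Nat using (ℕ; zero; suc; _+_; _≤_; _<_; z≤n; s≤s; _≟_)
open import Data.Nat.Properties
open import Data.Nat.ListAction using (sum)
open import Data.Nat.ListAction.Properties using (sum-++)
open import Data.Fin as Fin using (Fin; zero; suc)
import Data.Fin.Properties as Finₚ
open import Data.List using (List; []; _∷_; _++_; [_]; length; lookup; map; concatMap; cartesianProduct)
open import Data.List.Properties using (++-identityʳ; map-++; concatMap-++; length-++)
open import Data.List.Relation.Unary.All as All using (All; []; _∷_; all?)
open import Data.List.Relation.Unary.All.Properties as AllP using (++⁺; ++⁻ˡ; ++⁻ʳ; concat⁺)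
open import Data.List.Relation.Unary.Any as Any using (Any; here; there; any?)
open import Data.List.Relation.Unary.Any.Properties as AnyP using (lookup-index)
import Data.List.Relation.Unary.First as First
open import Data.List.Relation.Unary.First.Properties using (toView)
open import Data.List.Membership.Propositional using (_∈_; lose)
open import Data.List.Membership.Propositional.Properties
  using (∈-++⁺ˡ; ∈-++⁺ʳ; ∈-lookup; ∈-cartesianProduct⁺)
open import Data.Product using (Σ; _×_; _,_; proj₁; proj₂; ∃₂)
open import Data.Sum using (_⊎_; inj₁; inj₂)
open import Data.Empty using (⊥; ⊥-elim)
open import Data.Unit using (⊤; tt)
open import Function.Bundles using (_⇔_; mk⇔)
open import Relation.Nullary using (¬_; Dec; yes; no)
open import Relation.Nullary.Decidable using (_×-dec_)
open import Relation.Binary.PropositionalEquality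
  using (_≡_; _≢_; refl; sym; trans; cong; cong₂; subst₂; module ≡-Reasoning)
  renaming (subst to ≡-subst)

rename-cong : ∀ {n m} {ρ ρ' : Fin n → Fin m} → (∀ i → ρ i ≡ ρ' i) →
              ∀ M → rename ρ M ≡ rename ρ' M
rename-cong h (var i) = cong var (h i)
rename-cong h (con a) = refl
rename-cong h (A ＠ B) = cong₂ _＠_ (rename-cong h A) (rename-cong h B)
rename-cong h (A ⊃ B) = cong₂ _⊃_ (rename-cong h A) (rename-cong h B)
rename-cong h (A ⊕ B) = cong₂ _⊕_ (rename-cong h A) (rename-cong h B)
rename-cong {ρ = ρ} {ρ'} h (μ A) = cong μ_ (rename-cong h' A)
  where h' : ∀ i → ext ρ i ≡ ext ρ' i
        h' zero    = refl
        h' (suc i) = cong suc (h i)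

subst-cong : ∀ {n m} {σ σ' : Fin n → Ty m} → (∀ i → σ i ≡ σ' i) →
             ∀ M → subst σ M ≡ subst σ' M
subst-cong h (var i) = h i
subst-cong h (con a) = refl
subst-cong h (A ＠ B) = cong₂ _＠_ (subst-cong h A) (subst-cong h B)
subst-cong h (A ⊃ B) = cong₂ _⊃_ (subst-cong h A) (subst-cong h B)
subst-cong h (A ⊕ B) = cong₂ _⊕_ (subst-cong h A) (subst-cong h B)
subst-cong {σ = σ} {σ'} h (μ A) = cong μ_ (subst-cong h' A)
  where h' : ∀ i → exts σ i ≡ exts σ' i
        h' zero    = refl
        h' (suc i) = cong (rename suc) (h i)

rename-rename : ∀ {n m k} (ρ : Fin m → Fin k) (ρ' : Fin n → Fin m) M →
                rename ρ (rename ρ' M) ≡ rename (λ i → ρ (ρ' i)) M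
rename-rename ρ ρ' (var i) = refl
rename-rename ρ ρ' (con a) = refl
rename-rename ρ ρ' (A ＠ B) = cong₂ _＠_ (rename-rename ρ ρ' A) (rename-rename ρ ρ' B)
rename-rename ρ ρ' (A ⊃ B) = cong₂ _⊃_ (rename-rename ρ ρ' A) (rename-rename ρ ρ' B)
rename-rename ρ ρ' (A ⊕ B) = cong₂ _⊕_ (rename-rename ρ ρ' A) (rename-rename ρ ρ' B)
rename-rename ρ ρ' (μ A) =
  cong μ_ (trans (rename-rename (ext ρ) (ext ρ') A) (rename-cong h A))
  where h : ∀ i → ext ρ (ext ρ' i) ≡ ext (λ j → ρ (ρ' j)) i
        h zero    = refl
        h (suc i) = refl

subst-rename : ∀ {n m k} (σ : Fin m → Ty k) (ρ : Fin n → Fin m) M →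
               subst σ (rename ρ M) ≡ subst (λ i → σ (ρ i)) M
subst-rename σ ρ (var i) = refl
subst-rename σ ρ (con a) = refl
subst-rename σ ρ (A ＠ B) = cong₂ _＠_ (subst-rename σ ρ A) (subst-rename σ ρ B)
subst-rename σ ρ (A ⊃ B) = cong₂ _⊃_ (subst-rename σ ρ A) (subst-rename σ ρ B)
subst-rename σ ρ (A ⊕ B) = cong₂ _⊕_ (subst-rename σ ρ A) (subst-rename σ ρ B)
subst-rename σ ρ (μ A) =
  cong μ_ (trans (subst-rename (exts σ) (ext ρ) A) (subst-cong h A))
  where h : ∀ i → exts σ (ext ρ i) ≡ exts (λ j → σ (ρ j)) i
        h zero    = refl
        h (suc i) = refl

rename-subst : ∀ {n m k} (ρ : Fin m → Fin k) (σ : Fin n → Ty m) M →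
               rename ρ (subst σ M) ≡ subst (λ i → rename ρ (σ i)) M
rename-subst ρ σ (var i) = refl
rename-subst ρ σ (con a) = refl
rename-subst ρ σ (A ＠ B) = cong₂ _＠_ (rename-subst ρ σ A) (rename-subst ρ σ B)
rename-subst ρ σ (A ⊃ B) = cong₂ _⊃_ (rename-subst ρ σ A) (rename-subst ρ σ B)
rename-subst ρ σ (A ⊕ B) = cong₂ _⊕_ (rename-subst ρ σ A) (rename-subst ρ σ B)
rename-subst ρ σ (μ A) =
  cong μ_ (trans (rename-subst (ext ρ) (exts σ) A) (subst-cong h A))
  where h : ∀ i → rename (ext ρ) (exts σ i) ≡ exts (λ j → rename ρ (σ j)) i
        h zero    = refl
        h (suc i) = trans (rename-rename (ext ρ) suc (σ i)) (sym (rename-rename suc ρ (σ i)))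

subst-subst : ∀ {n m k} (τ : Fin m → Ty k) (σ : Fin n → Ty m) M →
              subst τ (subst σ M) ≡ subst (λ i → subst τ (σ i)) M
subst-subst τ σ (var i) = refl
subst-subst τ σ (con a) = refl
subst-subst τ σ (A ＠ B) = cong₂ _＠_ (subst-subst τ σ A) (subst-subst τ σ B)
subst-subst τ σ (A ⊃ B) = cong₂ _⊃_ (subst-subst τ σ A) (subst-subst τ σ B)
subst-subst τ σ (A ⊕ B) = cong₂ _⊕_ (subst-subst τ σ A) (subst-subst τ σ B)
subst-subst τ σ (μ A) =
  cong μ_ (trans (subst-subst (exts τ) (exts σ) A) (subst-cong h A))
  where h : ∀ i → subst (exts τ) (exts σ i) ≡ exts (λ j → subst τ (σ j)) i
        h zero    = refl
        h (suc i) = trans (subst-rename (exts τ) suc (σ i)) (sym (rename-subst suc τ (σ i)))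

subst-var : ∀ {n} (M : Ty n) → subst var M ≡ M
subst-var (var i) = refl
subst-var (con a) = refl
subst-var (A ＠ B) = cong₂ _＠_ (subst-var A) (subst-var B)
subst-var (A ⊃ B) = cong₂ _⊃_ (subst-var A) (subst-var B)
subst-var (A ⊕ B) = cong₂ _⊕_ (subst-var A) (subst-var B)
subst-var (μ A) = cong μ_ (trans (subst-cong h A) (subst-var A))
  where h : ∀ i → exts var i ≡ var i
        h zero    = refl
        h (suc i) = refl

infixr 5 _∷ₑ_
_∷ₑ_ : ∀ {n} → Ty 0 → (Fin n → Ty 0) → Fin (suc n) → Ty 0
(M ∷ₑ σ) zero    = M
(M ∷ₑ σ) (suc i) = σ i

-- Unfolding commutes with closing substitutions: unfolding the closed
-- instance of μV.C binds V to that very instance.  This is what makes the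
-- finite closure of a type (used for the converse direction) closed
-- under unfolding.
unfold-subst : ∀ {n} (σ : Fin n → Ty 0) (C : Ty (suc n)) →
  unfoldμ (subst (exts σ) C) ≡ subst ((μ subst (exts σ) C) ∷ₑ σ) C
unfold-subst σ C = trans (subst-subst _ (exts σ) C) (subst-cong (h _ refl) C)
  where
  M = μ subst (exts σ) C
  h : (τ : Fin 1 → Ty 0) → τ zero ≡ M → ∀ i → subst τ (exts σ i) ≡ (M ∷ₑ σ) i
  h τ e zero    = e
  h τ e (suc i) = trans (subst-rename τ suc (σ i))
                        (trans (subst-cong (λ ()) (σ i)) (subst-var (σ i)))

guarded-fresh : ∀ {n m} (ρ : Fin n → Fin m) {i} → (∀ j → ρ j ≢ i) →
                ∀ M → Guarded i (rename ρ M)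
guarded-fresh ρ h (var j) = λ e → h j (sym e)
guarded-fresh ρ h (con a) = tt
guarded-fresh ρ h (A ＠ B) = tt
guarded-fresh ρ h (A ⊃ B) = tt
guarded-fresh ρ h (A ⊕ B) = guarded-fresh ρ h A , guarded-fresh ρ h B
guarded-fresh ρ {i} h (μ A) = guarded-fresh (ext ρ) h' A
  where h' : ∀ j → ext ρ j ≢ suc i
        h' zero    ()
        h' (suc j) e = h j (Finₚ.suc-injective e)

Injective : ∀ {n m} → (Fin n → Fin m) → Set
Injective ρ = ∀ {a b} → ρ a ≡ ρ b → a ≡ b

ext-injective : ∀ {n m} {ρ : Fin n → Fin m} → Injective ρ → Injective (ext ρ)
ext-injective h {zero}  {zero}  e = refl
ext-injective h {zero}  {suc b} ()
ext-injective h {suc a} {zero}  ()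
ext-injective h {suc a} {suc b} e = cong suc (h (Finₚ.suc-injective e))

guarded-rename : ∀ {n m} (ρ : Fin n → Fin m) → Injective ρ →
                 ∀ {i} M → Guarded i M → Guarded (ρ i) (rename ρ M)
guarded-rename ρ inj (var j) g = λ e → g (inj e)
guarded-rename ρ inj (con a) g = tt
guarded-rename ρ inj (A ＠ B) g = tt
guarded-rename ρ inj (A ⊃ B) g = tt
guarded-rename ρ inj (A ⊕ B) (g , g') = guarded-rename ρ inj A g , guarded-rename ρ inj B g'
guarded-rename ρ inj (μ A) g = guarded-rename (ext ρ) (ext-injective inj) A g

contractive-rename : ∀ {n m} (ρ : Fin n → Fin m) → Injective ρ →
                     ∀ {M} → Contractive M → Contractive (rename ρ M)
contractive-rename ρ inj var       = var
contractive-rename ρ inj con       = con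
contractive-rename ρ inj (app c d) = app (contractive-rename ρ inj c) (contractive-rename ρ inj d)
contractive-rename ρ inj (fun c d) = fun (contractive-rename ρ inj c) (contractive-rename ρ inj d)
contractive-rename ρ inj (uni c d) = uni (contractive-rename ρ inj c) (contractive-rename ρ inj d)
contractive-rename ρ inj (rec {A} g c) =
  rec (guarded-rename (ext ρ) (ext-injective inj) A g)
      (contractive-rename (ext ρ) (ext-injective inj) c)

guarded-subst : ∀ {n m} (σ : Fin n → Ty m) {i i'} →
                (∀ j → i ≢ j → Guarded i' (σ j)) →
                ∀ C → Guarded i C → Guarded i' (subst σ C)
guarded-subst σ h (var j) g = h j g
guarded-subst σ h (con a) g = tt
guarded-subst σ h (A ＠ B) g = tt
guarded-subst σ h (A ⊃ B) g = tt
guarded-subst σ h (A ⊕ B) (g , g') = guarded-subst σ h A g , guarded-subst σ h B g'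
guarded-subst σ {i} {i'} h (μ A) g = guarded-subst (exts σ) h' A g
  where h' : ∀ j → suc i ≢ j → Guarded (suc i') (exts σ j)
        h' zero    _  ()
        h' (suc j) ne = guarded-rename suc Finₚ.suc-injective (σ j) (h j (λ e → ne (cong suc e)))

contractive-subst : ∀ {n m} (σ : Fin n → Ty m) → (∀ j → Contractive (σ j)) →
                    ∀ {C} → Contractive C → Contractive (subst σ C)
contractive-subst σ h (var {i})  = h i
contractive-subst σ h con        = con
contractive-subst σ h (app c d)  = app (contractive-subst σ h c) (contractive-subst σ h d)
contractive-subst σ h (fun c d)  = fun (contractive-subst σ h c) (contractive-subst σ h d)
contractive-subst σ h (uni c d)  = uni (contractive-subst σ h c) (contractive-subst σ h d)
contractive-subst σ h (rec {A} g c) =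
  rec (guarded-subst (exts σ) fresh A g) (contractive-subst (exts σ) cσ c)
  where fresh : ∀ j → zero ≢ j → Guarded zero (exts σ j)
        fresh zero    ne = ⊥-elim (ne refl)
        fresh (suc j) _  = guarded-fresh suc (λ j ()) (σ j)
        cσ : ∀ j → Contractive (exts σ j)
        cσ zero    = var
        cσ (suc j) = contractive-rename suc Finₚ.suc-injective (h j)

contractive-unfold : ∀ {C : Ty 1} → Contractive (μ C) → Contractive (unfoldμ C)
contractive-unfold {C} (rec g c) = contractive-subst _ (cσ _ refl) c
  where
        cσ : (τ : Fin 1 → Ty 0) → τ zero ≡ μ C → ∀ j → Contractive (τ j)
        cσ τ e zero rewrite e = rec g c

-- The head weight counts the union and μ nodes above the first proper
-- constructor (plus one per such component); the lead counts the
-- leading μ binders.  Both are invariant under unfolding a contractive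
-- μ-type, so the head weight bounds the work needed to expose the
-- components of a maximal union.

hw : ∀ {n} → Ty n → ℕ
hw (var i) = 1
hw (con a) = 1
hw (A ＠ B) = 1
hw (A ⊃ B) = 1
hw (A ⊕ B) = suc (hw A + hw B)
hw (μ A) = suc (hw A)

lead : ∀ {n} → Ty n → ℕ
lead (μ A) = suc (lead A)
lead _     = 0

hw≰0 : ∀ {n} (X : Ty n) → ¬ hw X ≤ 0
hw≰0 (var i) ()
hw≰0 (con a) ()
hw≰0 (A ＠ B) ()
hw≰0 (A ⊃ B) ()
hw≰0 (A ⊕ B) ()
hw≰0 (μ A) ()

lead<size : ∀ {n} (X : Ty n) → lead X < size X
lead<size (var i) = s≤s z≤n
lead<size (con a) = s≤s z≤n
lead<size (A ＠ B) = s≤s z≤n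
lead<size (A ⊃ B) = s≤s z≤n
lead<size (A ⊕ B) = s≤s z≤n
lead<size (μ A) = s≤s (lead<size A)

-- no bound variable occurs unguarded, so no variable is met in the head
HeadGuarded : ∀ {n} → Ty n → Set
HeadGuarded {n} C = ∀ (i : Fin n) → Guarded i C

head-guarded-body : ∀ {n} {A : Ty (suc n)} → Guarded zero A → HeadGuarded (μ A) →
                    HeadGuarded A
head-guarded-body g0 g zero    = g0
head-guarded-body g0 g (suc i) = g i

-- substitution acts on a head-guarded type only below its first proper
-- constructors, so it preserves head weight and lead
hw-subst : ∀ {n m} (σ : Fin n → Ty m) {C} → Contractive C → HeadGuarded C →
           hw (subst σ C) ≡ hw C
hw-subst σ (var {i}) g  = ⊥-elim (g i refl)
hw-subst σ con g        = refl
hw-subst σ (app c d) g  = refl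
hw-subst σ (fun c d) g  = refl
hw-subst σ (uni c d) g  =
  cong₂ (λ x y → suc (x + y)) (hw-subst σ c (λ i → proj₁ (g i))) (hw-subst σ d (λ i → proj₂ (g i)))
hw-subst σ (rec {A} g0 c) g = cong suc (hw-subst (exts σ) c (head-guarded-body {A = A} g0 g))

lead-subst : ∀ {n m} (σ : Fin n → Ty m) {C} → Contractive C → HeadGuarded C →
             lead (subst σ C) ≡ lead C
lead-subst σ (var {i}) g  = ⊥-elim (g i refl)
lead-subst σ con g        = refl
lead-subst σ (app c d) g  = refl
lead-subst σ (fun c d) g  = refl
lead-subst σ (uni c d) g  = refl
lead-subst σ (rec {A} g0 c) g = cong suc (lead-subst (exts σ) c (head-guarded-body {A = A} g0 g))

head-guarded-μ : ∀ {C : Ty 1} → Contractive (μ C) → HeadGuarded C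
head-guarded-μ (rec g c) zero = g

hw-unfold : ∀ {C : Ty 1} → Contractive (μ C) → hw (unfoldμ C) ≡ hw C
hw-unfold (rec g c) = hw-subst _ c (head-guarded-μ (rec g c))

lead-unfold : ∀ {C : Ty 1} → Contractive (μ C) → lead (unfoldμ C) ≡ lead C
lead-unfold (rec g c) = lead-subst _ c (head-guarded-μ (rec g c))

hw-unfold< : ∀ {C : Ty 1} → Contractive (μ C) → hw (unfoldμ C) < hw (μ C)
hw-unfold< c = s≤s (≤-reflexive (hw-unfold c))

Atom : Ty 0 → Set
Atom (con a) = ⊤
Atom (A ＠ B) = ⊤
Atom (A ⊃ B) = ⊤
Atom _       = ⊥

ContractiveAtom : Ty 0 → Set
ContractiveAtom x = Contractive x × Atom x

-- The normal form of a closed type: the list of atoms obtained by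
-- unfolding μ's in head position and flattening unions.  It is the list
-- of components of the maximal union at the root of T(X).
nfFuel : ℕ → Ty 0 → List (Ty 0)
nfFuel zero    X       = []
nfFuel (suc u) (var ())
nfFuel (suc u) (con a) = [ con a ]
nfFuel (suc u) (A ＠ B) = [ A ＠ B ]
nfFuel (suc u) (A ⊃ B) = [ A ⊃ B ]
nfFuel (suc u) (A ⊕ B) = nfFuel u A ++ nfFuel u B
nfFuel (suc u) (μ C)   = nfFuel u (unfoldμ C)

nf : Ty 0 → List (Ty 0)
nf X = nfFuel (hw X) X

hw⊕ˡ : ∀ {n} (A B : Ty n) → hw A ≤ hw A + hw B
hw⊕ˡ A B = m≤m+n (hw A) (hw B)

hw⊕ʳ : ∀ {n} (A B : Ty n) → hw B ≤ hw A + hw B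
hw⊕ʳ A B = m≤n+m (hw B) (hw A)

nfFuel-irrelevant : ∀ {X} → Contractive X → ∀ u v → hw X ≤ u → hw X ≤ v →
                    nfFuel u X ≡ nfFuel v X
nfFuel-irrelevant {X} c zero v p _ = ⊥-elim (hw≰0 X p)
nfFuel-irrelevant {X} c (suc u) zero _ q = ⊥-elim (hw≰0 X q)
nfFuel-irrelevant con       (suc u) (suc v) _ _ = refl
nfFuel-irrelevant (app _ _) (suc u) (suc v) _ _ = refl
nfFuel-irrelevant (fun _ _) (suc u) (suc v) _ _ = refl
nfFuel-irrelevant (uni {A} {B} c d) (suc u) (suc v) (s≤s p) (s≤s q) =
  cong₂ _++_ (nfFuel-irrelevant c u v (≤-trans (hw⊕ˡ A B) p) (≤-trans (hw⊕ˡ A B) q))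
             (nfFuel-irrelevant d u v (≤-trans (hw⊕ʳ A B) p) (≤-trans (hw⊕ʳ A B) q))
nfFuel-irrelevant (rec g c) (suc u) (suc v) (s≤s p) (s≤s q) =
  nfFuel-irrelevant (contractive-unfold (rec g c)) u v
    (≤-trans (≤-reflexive (hw-unfold (rec g c))) p) (≤-trans (≤-reflexive (hw-unfold (rec g c))) q)

nfFuel-nf : ∀ {X} → Contractive X → ∀ u → hw X ≤ u → nfFuel u X ≡ nf X
nfFuel-nf c u p = nfFuel-irrelevant c u _ p ≤-refl

nf-μ : ∀ {C} → Contractive (μ C) → nf (μ C) ≡ nf (unfoldμ C)
nf-μ {C} c = nfFuel-nf (contractive-unfold c) (hw C) (≤-reflexive (hw-unfold c))

nf-⊕ : ∀ {A B} → Contractive A → Contractive B → nf (A ⊕ B) ≡ nf A ++ nf B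
nf-⊕ {A} {B} c d = cong₂ _++_ (nfFuel-nf c _ (hw⊕ˡ A B)) (nfFuel-nf d _ (hw⊕ʳ A B))

nfFuel-atoms : ∀ u {X} → Contractive X → All ContractiveAtom (nfFuel u X)
nfFuel-atoms zero c = []
nfFuel-atoms (suc u) con = (con , tt) ∷ []
nfFuel-atoms (suc u) (app c d) = (app c d , tt) ∷ []
nfFuel-atoms (suc u) (fun c d) = (fun c d , tt) ∷ []
nfFuel-atoms (suc u) (uni c d) = ++⁺ (nfFuel-atoms u c) (nfFuel-atoms u d)
nfFuel-atoms (suc u) (rec g c) = nfFuel-atoms u (contractive-unfold (rec g c))

nf-atoms : ∀ {X} → Contractive X → All ContractiveAtom (nf X)
nf-atoms {X} = nfFuel-atoms (hw X)

nf-atom : ∀ {x} → Atom x → nf x ≡ [ x ]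
nf-atom {con a} _ = refl
nf-atom {A ＠ B} _ = refl
nf-atom {A ⊃ B} _ = refl

NonUnion : ∀ {n} → Ty n → Set
NonUnion (A ⊕ B) = ⊥
NonUnion _       = ⊤

flat-nonUnion : ∀ {n} (X : Ty n) → All NonUnion (flat X)
flat-nonUnion (var i) = tt ∷ []
flat-nonUnion (con a) = tt ∷ []
flat-nonUnion (A ＠ B) = tt ∷ []
flat-nonUnion (A ⊃ B) = tt ∷ []
flat-nonUnion (A ⊕ B) = ++⁺ (flat-nonUnion A) (flat-nonUnion B)
flat-nonUnion (μ A) = tt ∷ []

flat-contractive : ∀ {X : Ty 0} → Contractive X → All Contractive (flat X)
flat-contractive var = var ∷ []
flat-contractive con = con ∷ []
flat-contractive (app c d) = app c d ∷ []
flat-contractive (fun c d) = fun c d ∷ []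
flat-contractive (uni c d) = ++⁺ (flat-contractive c) (flat-contractive d)
flat-contractive (rec g c) = rec g c ∷ []

flat-nonUnion-single : ∀ {n} {X : Ty n} → NonUnion X → flat X ≡ [ X ]
flat-nonUnion-single {X = var i} _ = refl
flat-nonUnion-single {X = con a} _ = refl
flat-nonUnion-single {X = A ＠ B} _ = refl
flat-nonUnion-single {X = A ⊃ B} _ = refl
flat-nonUnion-single {X = μ A} _ = refl

flat-nonEmpty : ∀ {n} (X : Ty n) → 1 ≤ length (flat X)
flat-nonEmpty (var i) = s≤s z≤n
flat-nonEmpty (con a) = s≤s z≤n
flat-nonEmpty (A ＠ B) = s≤s z≤n
flat-nonEmpty (A ⊃ B) = s≤s z≤n
flat-nonEmpty (μ A) = s≤s z≤n
flat-nonEmpty (A ⊕ B) =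
  ≤-trans (flat-nonEmpty A) (≤-trans (m≤m+n _ _) (≤-reflexive (sym (length-++ (flat A)))))

flat-singleton : ∀ {n} (X : Ty n) {x} → flat X ≡ [ x ] → X ≡ x
flat-singleton (var i) refl = refl
flat-singleton (con a) refl = refl
flat-singleton (A ＠ B) refl = refl
flat-singleton (A ⊃ B) refl = refl
flat-singleton (μ A) refl = refl
flat-singleton (A ⊕ B) e = ⊥-elim (1+n≰n (begin
  2                                   ≤⟨ +-mono-≤ (flat-nonEmpty A) (flat-nonEmpty B) ⟩
  length (flat A) + length (flat B)   ≡⟨ sym (length-++ (flat A)) ⟩
  length (flat A ++ flat B)           ≡⟨ cong length e ⟩
  1                                   ∎))
  where open ≤-Reasoning

nf-flat : ∀ {X} → Contractive X → nf X ≡ concatMap nf (flat X)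
nf-flat {var ()} _
nf-flat {con a} _ = refl
nf-flat {A ＠ B} _ = refl
nf-flat {A ⊃ B} _ = refl
nf-flat {μ C} c = sym (++-identityʳ _)
nf-flat {A ⊕ B} (uni c d) = begin
  nf (A ⊕ B)                                      ≡⟨ nf-⊕ c d ⟩
  nf A ++ nf B                                    ≡⟨ cong₂ _++_ (nf-flat c) (nf-flat d) ⟩
  concatMap nf (flat A) ++ concatMap nf (flat B)  ≡⟨ sym (concatMap-++ nf (flat A) (flat B)) ⟩
  concatMap nf (flat A ++ flat B)                 ∎
  where open ≡-Reasoning

component-atom : ∀ {x : Ty 0} → NotMu x → NonUnion x → Atom x
component-atom {con a} _ _ = tt
component-atom {A ＠ B} _ _ = tt
component-atom {A ⊃ B} _ _ = tt

atom-nonUnion : ∀ {x : Ty 0} → Atom x → NonUnion x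
atom-nonUnion {con a} _ = tt
atom-nonUnion {A ＠ B} _ = tt
atom-nonUnion {A ⊃ B} _ = tt

nf-noμ : ∀ {X} → Contractive X → All NotMu (flat X) → nf X ≡ flat X
nf-noμ {X} c nm = trans (nf-flat c) (atoms (flat-nonUnion X) nm)
  where
  atoms : ∀ {xs : List (Ty 0)} → All NonUnion xs → All NotMu xs → concatMap nf xs ≡ xs
  atoms [] [] = refl
  atoms {x ∷ _} (u ∷ us) (m ∷ ms) = cong₂ _++_ (nf-atom (component-atom m u)) (atoms us ms)

weight : List (Ty 0) → ℕ
weight xs = sum (map (λ x → suc (hw x)) xs)

weight-++ : ∀ xs ys → weight (xs ++ ys) ≡ weight xs + weight ys
weight-++ xs ys = trans (cong sum (map-++ _ xs ys)) (sum-++ (map _ xs) _)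

hw-flat : ∀ (X : Ty 0) → suc (hw X) ≡ weight (flat X)
hw-flat (var ())
hw-flat (con a) = refl
hw-flat (A ＠ B) = refl
hw-flat (A ⊃ B) = refl
hw-flat (μ C) = cong suc (sym (+-identityʳ _))
hw-flat (A ⊕ B) = begin
  suc (suc (hw A + hw B))               ≡⟨ cong suc (sym (+-suc (hw A) (hw B))) ⟩
  suc (hw A) + suc (hw B)               ≡⟨ cong₂ _+_ (hw-flat A) (hw-flat B) ⟩
  weight (flat A) + weight (flat B)     ≡⟨ sym (weight-++ (flat A) (flat B)) ⟩
  weight (flat A ++ flat B)             ∎
  where open ≡-Reasoning

lookup≤weight : ∀ (xs : List (Ty 0)) i → suc (hw (lookup xs i)) ≤ weight xs
lookup≤weight (x ∷ xs) zero    = m≤m+n (suc (hw x)) (weight xs)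
lookup≤weight (x ∷ xs) (suc i) = ≤-trans (lookup≤weight xs i) (m≤n+m (weight xs) (suc (hw x)))

lookup<weight : ∀ (xs : List (Ty 0)) i → 2 ≤ length xs → suc (suc (hw (lookup xs i))) ≤ weight xs
lookup<weight (x ∷ []) zero (s≤s ())
lookup<weight (x ∷ y ∷ xs) zero _ =
  ≤-trans (≤-reflexive (+-comm 1 (suc (hw x)))) (+-monoʳ-≤ (suc (hw x)) (s≤s z≤n))
lookup<weight (x ∷ y ∷ xs) (suc i) _ = +-mono-≤ (s≤s z≤n) (lookup≤weight (y ∷ xs) i)

component-hw≤ : ∀ X i → hw (lookup (flat X) i) ≤ hw X
component-hw≤ X i = ≤-pred (≤-trans (lookup≤weight (flat X) i) (≤-reflexive (sym (hw-flat X))))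

component-hw< : ∀ X i → 2 ≤ length (flat X) → hw (lookup (flat X) i) < hw X
component-hw< X i l = ≤-pred (≤-trans (lookup<weight (flat X) i l) (≤-reflexive (sym (hw-flat X))))

⨁-contractive : ∀ {x : Ty 0} {ys} → Contractive x → All Contractive ys → Contractive (⨁ x ys)
⨁-contractive c []       = c
⨁-contractive c (d ∷ ds) = uni c (⨁-contractive d ds)

flat-⨁ : ∀ {n} (x : Ty n) ys → flat (⨁ x ys) ≡ concatMap flat (x ∷ ys)
flat-⨁ x []       = sym (++-identityʳ _)
flat-⨁ x (y ∷ ys) = cong (flat x ++_) (flat-⨁ y ys)

nf-⨁ : ∀ {x ys} → Contractive x → All Contractive ys → nf (⨁ x ys) ≡ concatMap nf (x ∷ ys)
nf-⨁ c []       = sym (++-identityʳ _)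
nf-⨁ c (d ∷ ds) = trans (nf-⊕ c (⨁-contractive d ds)) (cong (_ ++_) (nf-⨁ d ds))

hw-⨁ : ∀ x ys → suc (hw (⨁ x ys)) ≡ weight (x ∷ ys)
hw-⨁ x []       = cong suc (sym (+-identityʳ _))
hw-⨁ x (y ∷ ys) = trans (cong suc (sym (+-suc (hw x) _))) (cong (suc (hw x) +_) (hw-⨁ y ys))

-- a plugged context is the right-nested union of its component list, so
-- every fact about ⨁ transfers to plug
plug-as-⨁ : ∀ {n} (P : Ty n → List (Ty n) → Set) pre U post →
            (∀ z zs → P (⨁ z zs) (z ∷ zs)) → P (plug pre U post) (pre ++ U ∷ post)
plug-as-⨁ P []       U post h = h U post
plug-as-⨁ P (x ∷ xs) U post h = h x (xs ++ U ∷ post)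

flat-plug : ∀ {n} (pre : List (Ty n)) U post → flat (plug pre U post) ≡ concatMap flat (pre ++ U ∷ post)
flat-plug pre U post = plug-as-⨁ (λ T xs → flat T ≡ concatMap flat xs) pre U post flat-⨁

All-replace : ∀ {A : Set} {P : A → Set} pre {x y : A} {post} →
              All P (pre ++ x ∷ post) → P y → All P (pre ++ y ∷ post)
All-replace pre a py = ++⁺ (++⁻ˡ pre a) (py ∷ All.tail (++⁻ʳ pre a))

All-hole : ∀ {A : Set} {P : A → Set} pre {x : A} {post} → All P (pre ++ x ∷ post) → P x
All-hole pre a = All.head (++⁻ʳ pre a)

-- The premise of the rules μL/μR: unfolding the μ-component μC of the
-- maximal union of X gives a contractive type X' with the same normal
-- form and a strictly smaller head weight.
module UnfoldComponent {X : Ty 0} pre C post (cX : Contractive X)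
                       (e : flat X ≡ pre ++ (μ C) ∷ post) where

  X' : Ty 0
  X' = plug pre (unfoldμ C) post

  components : All Contractive (pre ++ (μ C) ∷ post)
  components = ≡-subst (All Contractive) e (flat-contractive cX)

  cμC : Contractive (μ C)
  cμC = All-hole pre components

  components' : All Contractive (pre ++ unfoldμ C ∷ post)
  components' = All-replace pre components (contractive-unfold cμC)

  contractive-X' : Contractive X'
  contractive-X' = plug-as-⨁ (λ T xs → All Contractive xs → Contractive T) pre (unfoldμ C) post
    (λ { z zs (c ∷ cs) → ⨁-contractive c cs }) components'

  nf-X' : nf X' ≡ nf X
  nf-X' = begin
    nf X'                                              ≡⟨ nf-plug ⟩
    concatMap nf (pre ++ unfoldμ C ∷ post)             ≡⟨ concatMap-++ nf pre _ ⟩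
    concatMap nf pre ++ nf (unfoldμ C) ++ concatMap nf post
      ≡⟨ cong (λ z → concatMap nf pre ++ z ++ concatMap nf post) (sym (nf-μ cμC)) ⟩
    concatMap nf pre ++ nf (μ C) ++ concatMap nf post  ≡⟨ sym (concatMap-++ nf pre _) ⟩
    concatMap nf (pre ++ μ C ∷ post)                   ≡⟨ cong (concatMap nf) (sym e) ⟩
    concatMap nf (flat X)                              ≡⟨ sym (nf-flat cX) ⟩
    nf X                                               ∎
    where
    open ≡-Reasoning
    nf-plug : nf X' ≡ concatMap nf (pre ++ unfoldμ C ∷ post)
    nf-plug = plug-as-⨁ (λ T xs → All Contractive xs → nf T ≡ concatMap nf xs) pre (unfoldμ C) post
      (λ { z zs (c ∷ cs) → nf-⨁ c cs }) components'

  hw-X' : hw X' < hw X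
  hw-X' = ≤-pred (begin-strict
    suc (hw X')
      ≡⟨ plug-as-⨁ (λ T xs → suc (hw T) ≡ weight xs) pre _ post hw-⨁ ⟩
    weight (pre ++ unfoldμ C ∷ post)                 ≡⟨ weight-++ pre _ ⟩
    weight pre + (suc (hw (unfoldμ C)) + weight post)
      <⟨ +-monoʳ-< (weight pre) (+-monoˡ-< (weight post) (s≤s (hw-unfold< cμC))) ⟩
    weight pre + (suc (hw (μ C)) + weight post)      ≡⟨ sym (weight-++ pre _) ⟩
    weight (pre ++ μ C ∷ post)                       ≡⟨ cong weight (sym e) ⟩
    weight (flat X)                                  ≡⟨ sym (hw-flat X) ⟩
    suc (hw X)                                       ∎)
    where open ≤-Reasoning

-- The truncation of T(X) at depth k, computed by recursion on the depth
-- and, at fixed depth, on a fuel bounding the head weight (unions and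
-- μ-unfoldings do not consume depth).
truncFuel : ℕ → ℕ → Ty 0 → FTree
truncFuel zero    u       X       = ∘
truncFuel (suc k) zero    X       = ∘
truncFuel (suc k) (suc u) (var ())
truncFuel (suc k) (suc u) (con a) = leaf a
truncFuel (suc k) (suc u) (A ＠ B) = truncFuel k (hw A) A ＠ᶠ truncFuel k (hw B) B
truncFuel (suc k) (suc u) (A ⊃ B) = truncFuel k (hw A) A ⊃ᶠ truncFuel k (hw B) B
truncFuel (suc k) (suc u) (A ⊕ B) = truncFuel (suc k) u A ⊕ᶠ truncFuel (suc k) u B
truncFuel (suc k) (suc u) (μ C)   = truncFuel (suc k) u (unfoldμ C)

trunc : ℕ → Ty 0 → FTree
trunc k X = truncFuel k (hw X) X

-- the truncation at depth k+1 of an atom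
atomTrunc : ℕ → Ty 0 → FTree
atomTrunc k (con a) = leaf a
atomTrunc k (A ＠ B) = trunc k A ＠ᶠ trunc k B
atomTrunc k (A ⊃ B) = trunc k A ⊃ᶠ trunc k B
atomTrunc k _       = ∘

-- The fuel of labelAt bounds the
-- number of consecutive head unfoldings; it suffices as long as it
-- exceeds the number of leading μ's, which is invariant under unfolding.
truncFuel-correct : ∀ k u f {X} → Contractive X → hw X ≤ u → lead X ≤ f →
                    labelAt f X ∣ k ↦ truncFuel k u X
truncFuel-correct zero u f c p q = zero
truncFuel-correct (suc k) zero f {X} c p q = ⊥-elim (hw≰0 X p)
truncFuel-correct (suc k) (suc u) f con p q = leaf refl
truncFuel-correct (suc k) (suc u) f (app {A} {B} c d) p q =
  app refl (truncFuel-correct k (hw A) (size A) c ≤-refl (<⇒≤ (lead<size A)))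
           (truncFuel-correct k (hw B) (size B) d ≤-refl (<⇒≤ (lead<size B)))
truncFuel-correct (suc k) (suc u) f (fun {A} {B} c d) p q =
  fun refl (truncFuel-correct k (hw A) (size A) c ≤-refl (<⇒≤ (lead<size A)))
           (truncFuel-correct k (hw B) (size B) d ≤-refl (<⇒≤ (lead<size B)))
truncFuel-correct (suc k) (suc u) f (uni {A} {B} c d) (s≤s p) q =
  uni refl (truncFuel-correct (suc k) u (size A) c (≤-trans (hw⊕ˡ A B) p) (<⇒≤ (lead<size A)))
           (truncFuel-correct (suc k) u (size B) d (≤-trans (hw⊕ʳ A B) p) (<⇒≤ (lead<size B)))
truncFuel-correct (suc k) (suc u) (suc f) (rec g c) (s≤s p) (s≤s q) =
  truncFuel-correct (suc k) u f (contractive-unfold (rec g c))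
    (≤-trans (≤-reflexive (hw-unfold (rec g c))) p) (≤-trans (≤-reflexive (lead-unfold (rec g c))) q)

trunc-T : ∀ k {X} → Contractive X → T X ∣ k ↦ trunc k X
trunc-T k {X} c = truncFuel-correct k (hw X) (size X) c ≤-refl (<⇒≤ (lead<size X))

truncFuel-components : ∀ k u {X} → Contractive X → hw X ≤ u →
                       flatᶠ (truncFuel (suc k) u X) ≡ map (atomTrunc k) (nfFuel u X)
truncFuel-components k zero {X} c p = ⊥-elim (hw≰0 X p)
truncFuel-components k (suc u) con p = refl
truncFuel-components k (suc u) (app c d) p = refl
truncFuel-components k (suc u) (fun c d) p = refl
truncFuel-components k (suc u) (uni {A} {B} c d) (s≤s p) =
  trans (cong₂ _++_ (truncFuel-components k u c (≤-trans (hw⊕ˡ A B) p))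
                    (truncFuel-components k u d (≤-trans (hw⊕ʳ A B) p)))
        (sym (map-++ (atomTrunc k) (nfFuel u A) (nfFuel u B)))
truncFuel-components k (suc u) (rec g c) (s≤s p) =
  truncFuel-components k u (contractive-unfold (rec g c)) (≤-trans (≤-reflexive (hw-unfold (rec g c))) p)

trunc-components : ∀ k {X} → Contractive X → flatᶠ (trunc (suc k) X) ≡ map (atomTrunc k) (nf X)
trunc-components k {X} c = truncFuel-components k (hw X) c ≤-refl

root : FTree → Label
root ∘        = leaf 0
root (leaf a) = leaf a
root (_ ＠ᶠ _) = app
root (_ ⊃ᶠ _) = fun
root (_ ⊕ᶠ _) = uni

↦-root : ∀ {t k s} → t ∣ suc k ↦ s → t [] ≡ root s
↦-root (leaf e)    = e
↦-root (app e _ _) = e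
↦-root (fun e _ _) = e
↦-root (uni e _ _) = e

mutual
  ↦-functional : ∀ {t k s s'} → t ∣ k ↦ s → t ∣ k ↦ s' → s ≡ s'
  ↦-functional zero zero = refl
  ↦-functional {k = suc k} p q = same-root p q (trans (sym (↦-root p)) (↦-root q))

  same-root : ∀ {t k s s'} → t ∣ suc k ↦ s → t ∣ suc k ↦ s' → root s ≡ root s' → s ≡ s'
  same-root (leaf _)    (leaf _)      refl = refl
  same-root (app _ p q) (app _ p' q') _    = cong₂ _＠ᶠ_ (↦-functional p p') (↦-functional q q')
  same-root (fun _ p q) (fun _ p' q') _    = cong₂ _⊃ᶠ_ (↦-functional p p') (↦-functional q q')
  same-root (uni _ p q) (uni _ p' q') _    = cong₂ _⊕ᶠ_ (↦-functional p p') (↦-functional q q')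
  same-root (leaf _)    (app _ _ _) ()
  same-root (leaf _)    (fun _ _ _) ()
  same-root (leaf _)    (uni _ _ _) ()
  same-root (app _ _ _) (leaf _)    ()
  same-root (app _ _ _) (fun _ _ _) ()
  same-root (app _ _ _) (uni _ _ _) ()
  same-root (fun _ _ _) (leaf _)    ()
  same-root (fun _ _ _) (app _ _ _) ()
  same-root (fun _ _ _) (uni _ _ _) ()
  same-root (uni _ _ _) (leaf _)    ()
  same-root (uni _ _ _) (app _ _ _) ()
  same-root (uni _ _ _) (fun _ _ _) ()

All-at : ∀ {A : Set} {P : A → Set} {xs} → All P xs → ∀ i → P (lookup xs i)
All-at pxs i = All.lookup pxs (∈-lookup i)

-- Two lists are similar under R when every element of either list is
-- R-related to some element of the other.  This is the content of the
-- union rules of ≃μ and ≃𝔗, with the index functions f, g made implicit.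
Sim : ∀ {A B : Set} → (A → B → Set) → List A → List B → Set
Sim R xs ys = All (λ x → Any (R x) ys) xs × All (λ y → Any (λ x → R x y) xs) ys

module _ {A B : Set} {R S : A → B → Set} where

  Sim-map : (∀ {x y} → R x y → S x y) → ∀ {xs ys} → Sim R xs ys → Sim S xs ys
  Sim-map h (l , r) = All.map (Any.map h) l , All.map (Any.map h) r

  Sim-map-with : ∀ {P : A → Set} {Q : B → Set} → (∀ {x y} → P x → Q y → R x y → S x y) →
                 ∀ {xs ys} → All P xs → All Q ys → Sim R xs ys → Sim S xs ys
  Sim-map-with h px qy (l , r) =
    All.zipWith (λ (p , a) → Any-map-with (λ q → h p q) qy a) (px , l) ,
    All.zipWith (λ (q , a) → Any-map-with (λ p → h p q) px a) (qy , r)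
    where
    Any-map-with : ∀ {C : Set} {T U V : C → Set} {zs} → (∀ {z} → T z → U z → V z) →
                   All T zs → Any U zs → Any V zs
    Any-map-with f (t ∷ ts) (here u)  = here (f t u)
    Any-map-with f (t ∷ ts) (there u) = there (Any-map-with f ts u)

module _ {A B : Set} {R : A → B → Set} where

  Sim-singleton : ∀ {x y} → R x y → Sim R [ x ] [ y ]
  Sim-singleton r = (here r ∷ []) , (here r ∷ [])

  Sim-singleton⁻ : ∀ {x y} → Sim R [ x ] [ y ] → R x y
  Sim-singleton⁻ ((here r ∷ []) , _) = r

  Sim-map⁺ : ∀ {C D : Set} {f : C → A} {g : D → B} {xs ys} →
             Sim (λ x y → R (f x) (g y)) xs ys → Sim R (map f xs) (map g ys)
  Sim-map⁺ (l , r) = AllP.map⁺ (All.map AnyP.map⁺ l) , AllP.map⁺ (All.map AnyP.map⁺ r)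

  Sim-map⁻ : ∀ {C D : Set} {f : C → A} {g : D → B} {xs ys} →
             Sim R (map f xs) (map g ys) → Sim (λ x y → R (f x) (g y)) xs ys
  Sim-map⁻ (l , r) = All.map AnyP.map⁻ (AllP.map⁻ l) , All.map AnyP.map⁻ (AllP.map⁻ r)

  IndexSim : List A → List B → Set
  IndexSim xs ys =
    (Σ (Fin (length xs) → Fin (length ys)) λ f → ∀ i → R (lookup xs i) (lookup ys (f i))) ×
    (Σ (Fin (length ys) → Fin (length xs)) λ g → ∀ j → R (lookup xs (g j)) (lookup ys j))

  Sim⇒IndexSim : ∀ {xs ys} → Sim R xs ys → IndexSim xs ys
  Sim⇒IndexSim (l , r) =
    ((λ i → Any.index (All-at l i)) , λ i → lookup-index (All-at l i)) ,
    ((λ j → Any.index (All-at r j)) , λ j → lookup-index (All-at r j))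

  IndexSim⇒Sim : ∀ {xs ys} → IndexSim xs ys → Sim R xs ys
  IndexSim⇒Sim ((f , fR) , (g , gR)) =
    tabulate (λ i → lose (∈-lookup (f i)) (fR i)) , tabulate (λ j → lose (∈-lookup (g j)) (gR j))
    where
    tabulate : ∀ {C : Set} {P : C → Set} {zs} → (∀ i → P (lookup zs i)) → All P zs
    tabulate {zs = []}    h = []
    tabulate {zs = z ∷ zs} h = h Fin.zero ∷ tabulate (λ i → h (Fin.suc i))

Sim? : ∀ {A B : Set} {R : A → B → Set} → (∀ x y → Dec (R x y)) → ∀ xs ys → Dec (Sim R xs ys)
Sim? R? xs ys = all? (λ x → any? (R? x) ys) xs ×-dec all? (λ y → any? (λ x → R? x y) xs) ys

AtomRel : (Ty 0 → Ty 0 → Set) → Ty 0 → Ty 0 → Set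
AtomRel R (con a) (con b) = a ≡ b
AtomRel R (D ＠ A) (D' ＠ A') = R D D' × R A A'
AtomRel R (A ⊃ B) (A' ⊃ B') = R A A' × R B B'
AtomRel R _ _ = ⊥

AtomRel-map : ∀ {R S} → (∀ {X Y} → R X Y → S X Y) → ∀ {x y} → AtomRel R x y → AtomRel S x y
AtomRel-map h {con a} {con b} e = e
AtomRel-map h {D ＠ A} {D' ＠ A'} (p , q) = h p , h q
AtomRel-map h {A ⊃ B} {A' ⊃ B'} (p , q) = h p , h q

AtomRel-map-contractive : ∀ {R S} → (∀ {X Y} → Contractive X → Contractive Y → R X Y → S X Y) →
                          ∀ {x y} → ContractiveAtom x → ContractiveAtom y → AtomRel R x y → AtomRel S x y
AtomRel-map-contractive h {con a} {con b} _ _ e = e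
AtomRel-map-contractive h {D ＠ A} {D' ＠ A'} (app c d , _) (app c' d' , _) (p , q) = h c c' p , h d d' q
AtomRel-map-contractive h {A ⊃ B} {A' ⊃ B'} (fun c d , _) (fun c' d' , _) (p , q) = h c c' p , h d d' q

AtomRel? : ∀ {R} → (∀ X Y → Dec (R X Y)) → ∀ x y → Dec (AtomRel R x y)
AtomRel? R? (con a) (con b) = a ≟ b
AtomRel? R? (D ＠ A) (D' ＠ A') = R? D D' ×-dec R? A A'
AtomRel? R? (A ⊃ B) (A' ⊃ B') = R? A A' ×-dec R? B B'
AtomRel? R? (con a) (_ ＠ _) = no λ ()
AtomRel? R? (con a) (_ ⊃ _) = no λ ()
AtomRel? R? (con a) (_ ⊕ _) = no λ ()
AtomRel? R? (con a) (μ _) = no λ ()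
AtomRel? R? (_ ＠ _) (con b) = no λ ()
AtomRel? R? (_ ＠ _) (_ ⊃ _) = no λ ()
AtomRel? R? (_ ＠ _) (_ ⊕ _) = no λ ()
AtomRel? R? (_ ＠ _) (μ _) = no λ ()
AtomRel? R? (_ ⊃ _) (con b) = no λ ()
AtomRel? R? (_ ⊃ _) (_ ＠ _) = no λ ()
AtomRel? R? (_ ⊃ _) (_ ⊕ _) = no λ ()
AtomRel? R? (_ ⊃ _) (μ _) = no λ ()
AtomRel? R? (_ ⊕ _) y = no λ ()
AtomRel? R? (μ _) y = no λ ()

-- Approximate equivalence up to depth k: the normal forms are similar,
-- with corresponding atoms having the same constructor and subterms
-- equivalent up to depth k - 1.  This is ≃𝔗 on depth-k truncations read
-- back on types (see tree-bisim⇒Approx and Approx⇒≃𝔗 below).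
Approx : ℕ → Ty 0 → Ty 0 → Set
Approx zero    X Y = ⊤
Approx (suc k) X Y = Sim (AtomRel (Approx k)) (nf X) (nf Y)

Approx-suc⇒Approx : ∀ k {X Y} → Approx (suc k) X Y → Approx k X Y
Approx-suc⇒Approx zero    _ = tt
Approx-suc⇒Approx (suc k) s = Sim-map (AtomRel-map (Approx-suc⇒Approx k)) s

Approx? : ∀ k X Y → Dec (Approx k X Y)
Approx? zero    X Y = yes tt
Approx? (suc k) X Y = Sim? (AtomRel? (Approx? k)) (nf X) (nf Y)

data UnionShape {A B : Set} (xs : List A) (ys : List B) : Set where
  singletons : ∀ {x y} → xs ≡ [ x ] → ys ≡ [ y ] → UnionShape xs ys
  union      : 2 < length xs + length ys → UnionShape xs ys

union-shape : ∀ {A B : Set} (xs : List A) (ys : List B) → 1 ≤ length xs → 1 ≤ length ys →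
              UnionShape xs ys
union-shape (x ∷ [])      (y ∷ [])      _ _ = singletons refl refl
union-shape (x ∷ [])      (y ∷ y' ∷ ys) _ _ = union (s≤s (s≤s (s≤s z≤n)))
union-shape (x ∷ x' ∷ xs) (y ∷ ys)      _ _ =
  union (s≤s (s≤s (≤-trans (s≤s z≤n) (m≤n+m (suc (length ys)) (length xs)))))

union-side : ∀ m n → 2 < m + n → 2 ≤ m ⊎ 2 ≤ n
union-side 0 n l = inj₂ (<⇒≤ l)
union-side 1 n l = inj₂ (≤-pred l)
union-side (suc (suc m)) n l = inj₁ (s≤s (s≤s z≤n))

FNonUnion : FTree → Set
FNonUnion (t ⊕ᶠ u) = ⊥
FNonUnion _        = ⊤

flatᶠ-nonUnion : ∀ t → All FNonUnion (flatᶠ t)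
flatᶠ-nonUnion (t ⊕ᶠ u) = ++⁺ (flatᶠ-nonUnion t) (flatᶠ-nonUnion u)
flatᶠ-nonUnion ∘        = tt ∷ []
flatᶠ-nonUnion (leaf a) = tt ∷ []
flatᶠ-nonUnion (t ＠ᶠ u) = tt ∷ []
flatᶠ-nonUnion (t ⊃ᶠ u) = tt ∷ []

flatᶠ-nonUnion-single : ∀ {t} → FNonUnion t → flatᶠ t ≡ [ t ]
flatᶠ-nonUnion-single {∘}      _ = refl
flatᶠ-nonUnion-single {leaf a} _ = refl
flatᶠ-nonUnion-single {t ＠ᶠ u} _ = refl
flatᶠ-nonUnion-single {t ⊃ᶠ u} _ = refl

flatᶠ-nonEmpty : ∀ t → 1 ≤ length (flatᶠ t)
flatᶠ-nonEmpty (t ⊕ᶠ u) =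
  ≤-trans (flatᶠ-nonEmpty t) (≤-trans (m≤m+n _ _) (≤-reflexive (sym (length-++ (flatᶠ t)))))
flatᶠ-nonEmpty ∘        = s≤s z≤n
flatᶠ-nonEmpty (leaf a) = s≤s z≤n
flatᶠ-nonEmpty (t ＠ᶠ u) = s≤s z≤n
flatᶠ-nonEmpty (t ⊃ᶠ u) = s≤s z≤n

flatᶠ-singleton : ∀ t {s} → flatᶠ t ≡ [ s ] → t ≡ s
flatᶠ-singleton ∘        refl = refl
flatᶠ-singleton (leaf a) refl = refl
flatᶠ-singleton (t ＠ᶠ u) refl = refl
flatᶠ-singleton (t ⊃ᶠ u) refl = refl
flatᶠ-singleton (t ⊕ᶠ u) e = ⊥-elim (1+n≰n (begin
  2                                   ≤⟨ +-mono-≤ (flatᶠ-nonEmpty t) (flatᶠ-nonEmpty u) ⟩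
  length (flatᶠ t) + length (flatᶠ u) ≡⟨ sym (length-++ (flatᶠ t)) ⟩
  length (flatᶠ t ++ flatᶠ u)         ≡⟨ cong length e ⟩
  1                                   ∎))
  where open ≤-Reasoning

data AtomT (R : FTree → FTree → Set) : FTree → FTree → Set where
  circ : AtomT R ∘ ∘
  con  : ∀ {a} → AtomT R (leaf a) (leaf a)
  app  : ∀ {d d' a a'} → R d d' → R a a' → AtomT R (d ＠ᶠ a) (d' ＠ᶠ a')
  fun  : ∀ {a a' b b'} → R a a' → R b b' → AtomT R (a ⊃ᶠ b) (a' ⊃ᶠ b')

StepT⇒AtomT : ∀ {R t u} → FNonUnion t → FNonUnion u → StepT R t u → AtomT R t u
StepT⇒AtomT nt nu circ = circ
StepT⇒AtomT nt nu con = con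
StepT⇒AtomT nt nu (app p q) = app p q
StepT⇒AtomT nt nu (fun p q) = fun p q
StepT⇒AtomT nt nu (uni l _ _ _ _) =
  ⊥-elim (n≮n 2 (subst₂ (λ xs ys → 2 < length xs + length ys)
                        (flatᶠ-nonUnion-single nt) (flatᶠ-nonUnion-single nu) l))

step-components : ∀ {R} → (∀ {x y} → R x y → StepT R x y) →
                  ∀ {t u} → StepT R t u → Sim (AtomT R) (flatᶠ t) (flatᶠ u)
step-components step circ      = Sim-singleton circ
step-components step con       = Sim-singleton con
step-components step (app p q) = Sim-singleton (app p q)
step-components step (fun p q) = Sim-singleton (fun p q)
step-components step {t} {u} (uni l f fR g gR) =
  Sim-map-with (λ nx ny r → StepT⇒AtomT nx ny (step r)) (flatᶠ-nonUnion t) (flatᶠ-nonUnion u)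
               (IndexSim⇒Sim ((f , fR) , (g , gR)))

components-step : ∀ {R S : FTree → FTree → Set} → (∀ {a b} → S a b → R a b) →
                  (∀ {a b} → S a b → StepT R a b) →
                  ∀ {t u} → Sim S (flatᶠ t) (flatᶠ u) → StepT R t u
components-step {R} {S} S⊆R S-step {t} {u} s
  with union-shape (flatᶠ t) (flatᶠ u) (flatᶠ-nonEmpty t) (flatᶠ-nonEmpty u)
... | union l =
  let ((f , fR) , (g , gR)) = Sim⇒IndexSim (Sim-map S⊆R s) in uni l f fR g gR
... | singletons et eu with flatᶠ-singleton t et | flatᶠ-singleton u eu
...   | refl | refl = S-step (Sim-singleton⁻ (subst₂ (Sim S) et eu s))

AtomT-atomTrunc : ∀ {R k x y} → Atom x → Atom y → AtomT R (atomTrunc k x) (atomTrunc k y) →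
                  AtomRel (λ X Y → R (trunc k X) (trunc k Y)) x y
AtomT-atomTrunc {x = con a}  {con b}  _ _ con       = refl
AtomT-atomTrunc {x = D ＠ A} {D' ＠ A'} _ _ (app p q) = p , q
AtomT-atomTrunc {x = A ⊃ B}  {A' ⊃ B'} _ _ (fun p q) = p , q
AtomT-atomTrunc {x = con a}  {_ ＠ _} _ _ ()
AtomT-atomTrunc {x = con a}  {_ ⊃ _} _ _ ()
AtomT-atomTrunc {x = _ ＠ _} {con b} _ _ ()
AtomT-atomTrunc {x = _ ＠ _} {_ ⊃ _} _ _ ()
AtomT-atomTrunc {x = _ ⊃ _}  {con b} _ _ ()
AtomT-atomTrunc {x = _ ⊃ _}  {_ ＠ _} _ _ ()

tree-bisim⇒Approx : ∀ {R} → (∀ {x y} → R x y → StepT R x y) →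
                    ∀ k {X Y} → Contractive X → Contractive Y → R (trunc k X) (trunc k Y) → Approx k X Y
tree-bisim⇒Approx step zero    _  _  _ = _
tree-bisim⇒Approx {R} step (suc k) {X} {Y} cX cY r =
  Sim-map-with atom-relation (nf-atoms cX) (nf-atoms cY) (Sim-map⁻ components)
  where
  components : Sim (AtomT R) (map (atomTrunc k) (nf X)) (map (atomTrunc k) (nf Y))
  components = subst₂ (Sim (AtomT R)) (trunc-components k cX) (trunc-components k cY)
                      (step-components step (step r))
  atom-relation : ∀ {x y} → ContractiveAtom x → ContractiveAtom y →
                  AtomT R (atomTrunc k x) (atomTrunc k y) → AtomRel (Approx k) x y
  atom-relation cx cy p = AtomRel-map-contractive (tree-bisim⇒Approx step k) cx cy
                            (AtomT-atomTrunc (proj₂ cx) (proj₂ cy) p)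

-- The bisimulation relates truncations of
-- approximately equivalent types and, for the union components, the
-- truncations of related atoms.
data AtomTruncRel : FTree → FTree → Set where
  atoms : ∀ k {x y} → ContractiveAtom x → ContractiveAtom y → AtomRel (Approx k) x y →
          AtomTruncRel (atomTrunc k x) (atomTrunc k y)

data TruncRel : FTree → FTree → Set where
  truncs    : ∀ k {X Y} → Contractive X → Contractive Y → Approx k X Y → TruncRel (trunc k X) (trunc k Y)
  atomic    : ∀ {a b} → AtomTruncRel a b → TruncRel a b

atomTrunc-step : ∀ {a b} → AtomTruncRel a b → StepT TruncRel a b
atomTrunc-step (atoms k {con a} {con .a} _ _ refl) = con
atomTrunc-step (atoms k {D ＠ A} {D' ＠ A'} (app c d , _) (app c' d' , _) (p , q)) =
  app (truncs k c c' p) (truncs k d d' q)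
atomTrunc-step (atoms k {A ⊃ B} {A' ⊃ B'} (fun c d , _) (fun c' d' , _) (p , q)) =
  fun (truncs k c c' p) (truncs k d d' q)

truncRel-step : ∀ {t u} → TruncRel t u → StepT TruncRel t u
truncRel-step (truncs zero _ _ _) = circ
truncRel-step (truncs (suc k) {X} {Y} cX cY e) =
  components-step atomic atomTrunc-step
    (subst₂ (Sim AtomTruncRel) (sym (trunc-components k cX)) (sym (trunc-components k cY))
            (Sim-map⁺ (Sim-map-with (atoms k) (nf-atoms cX) (nf-atoms cY) e)))
truncRel-step (atomic p) = atomTrunc-step p

Approx⇒≃𝔗 : ∀ k {X Y} → Contractive X → Contractive Y → Approx k X Y → trunc k X ≃𝔗 trunc k Y
Approx⇒≃𝔗 k cX cY e = TruncRel , truncs k cX cY e , truncRel-step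

module _ {R : Ty 0 → Ty 0 → Set} (step : ∀ {X Y} → R X Y → StepMu R X Y) where

  -- Induction on the total head
  -- weight, which decreases both when μL/μR unfold a component and when
  -- the union rule passes to components.
  bisim-nf : ∀ n {X Y} → hw X + hw Y < n → Contractive X → Contractive Y → R X Y →
             Sim (AtomRel R) (nf X) (nf Y)
  bisim-nf (suc n) {X} {Y} l cX cY r = by-rule (step r)
    where
    by-rule : StepMu R X Y → Sim (AtomRel R) (nf X) (nf Y)
    by-rule con       = Sim-singleton refl
    by-rule (app p q) = Sim-singleton (p , q)
    by-rule (fun p q) = Sim-singleton (p , q)
    by-rule (μL pre C post e _ r') =
      ≡-subst (λ z → Sim (AtomRel R) z (nf Y)) nf-X'
        (bisim-nf n (<-≤-trans (+-monoˡ-< (hw Y) hw-X') (≤-pred l)) contractive-X' cY r')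
      where open UnfoldComponent pre C post cX e
    by-rule (μR pre C post _ e _ r') =
      ≡-subst (λ z → Sim (AtomRel R) (nf X) z) nf-X'
        (bisim-nf n (<-≤-trans (+-monoʳ-< (hw X) hw-X') (≤-pred l)) cX contractive-X' r')
      where open UnfoldComponent pre C post cY e
    by-rule (uni lg nmX nmY f fR g gR) =
      subst₂ (Sim (AtomRel R)) (sym (nf-noμ cX nmX)) (sym (nf-noμ cY nmY))
        (IndexSim⇒Sim ((f , λ i → component i (f i) (fR i)) , (g , λ j → component (g j) j (gR j))))
      where
      smaller : ∀ i j → hw (lookup (flat X) i) + hw (lookup (flat Y) j) < hw X + hw Y
      smaller i j with union-side _ _ lg
      ... | inj₁ p = +-mono-<-≤ (component-hw< X i p) (component-hw≤ Y j)
      ... | inj₂ q = +-mono-≤-< (component-hw≤ X i) (component-hw< Y j q)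
      atom : ∀ {Z} → All NotMu (flat Z) → ∀ i → Atom (lookup (flat Z) i)
      atom {Z} nm i = component-atom (All-at nm i) (All-at (flat-nonUnion Z) i)
      component : ∀ i j → R (lookup (flat X) i) (lookup (flat Y) j) →
                  AtomRel R (lookup (flat X) i) (lookup (flat Y) j)
      component i j r = Sim-singleton⁻ (subst₂ (Sim (AtomRel R))
                                               (nf-atom (atom {X} nmX i)) (nf-atom (atom {Y} nmY j))
        (bisim-nf n (<-≤-trans (smaller i j) (≤-pred l))
                  (All-at (flat-contractive cX) i) (All-at (flat-contractive cY) j) r))

  bisim⇒Approx : ∀ k {X Y} → Contractive X → Contractive Y → R X Y → Approx k X Y
  bisim⇒Approx zero    _  _  _ = _
  bisim⇒Approx (suc k) cX cY r =
    Sim-map-with (AtomRel-map-contractive (bisim⇒Approx k)) (nf-atoms cX) (nf-atoms cY)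
                 (bisim-nf _ ≤-refl cX cY r)

-- The types reachable from a closed type
-- by taking immediate subterms and unfolded μ's are, up to the
-- substitution of its μ-types for their variables, instances of its
-- subterms; so there are finitely many.

SuccIn : List (Ty 0) → Ty 0 → Set
SuccIn L (var ())
SuccIn L (con a) = ⊤
SuccIn L (A ＠ B) = A ∈ L × B ∈ L
SuccIn L (A ⊃ B) = A ∈ L × B ∈ L
SuccIn L (A ⊕ B) = A ∈ L × B ∈ L
SuccIn L (μ C)   = unfoldμ C ∈ L

-- the closed instances of the subterms of X, where σ closes the
-- variables bound above X by their μ-types
subterms : ∀ {n} → (Fin n → Ty 0) → Ty n → List (Ty 0)
subterms σ (var i) = [ σ i ]
subterms σ (con a) = [ con a ]
subterms σ (A ＠ B) = subst σ (A ＠ B) ∷ subterms σ A ++ subterms σ B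
subterms σ (A ⊃ B) = subst σ (A ⊃ B) ∷ subterms σ A ++ subterms σ B
subterms σ (A ⊕ B) = subst σ (A ⊕ B) ∷ subterms σ A ++ subterms σ B
subterms σ (μ C)   = subst σ (μ C) ∷ subterms (subst σ (μ C) ∷ₑ σ) C

subterms-self : ∀ {n} (σ : Fin n → Ty 0) X → subst σ X ∈ subterms σ X
subterms-self σ (var i) = here refl
subterms-self σ (con a) = here refl
subterms-self σ (A ＠ B) = here refl
subterms-self σ (A ⊃ B) = here refl
subterms-self σ (A ⊕ B) = here refl
subterms-self σ (μ C)   = here refl

module _ (L : List (Ty 0)) where

  children-in : ∀ {n} (σ : Fin n → Ty 0) A B {top} →
                (∀ {x} → x ∈ top ∷ subterms σ A ++ subterms σ B → x ∈ L) →
                subst σ A ∈ L × subst σ B ∈ L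
  children-in σ A B ⊆L = ⊆L (there (∈-++⁺ˡ (subterms-self σ A))) ,
                         ⊆L (there (∈-++⁺ʳ (subterms σ A) (subterms-self σ B)))

  mutual
    subterms-closed : ∀ {n} (σ : Fin n → Ty 0) X → (∀ {x} → x ∈ subterms σ X → x ∈ L) →
                      (∀ i → SuccIn L (σ i)) → All (SuccIn L) (subterms σ X)
    subterms-closed σ (var i) ⊆L h = h i ∷ []
    subterms-closed σ (con a) ⊆L h = tt ∷ []
    subterms-closed σ (A ＠ B) ⊆L h = children-in σ A B ⊆L ∷ subterms-closed-children σ A B ⊆L h
    subterms-closed σ (A ⊃ B) ⊆L h = children-in σ A B ⊆L ∷ subterms-closed-children σ A B ⊆L h
    subterms-closed σ (A ⊕ B) ⊆L h = children-in σ A B ⊆L ∷ subterms-closed-children σ A B ⊆L h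
    subterms-closed σ (μ C) ⊆L h = unfolded ∷ subterms-closed (M ∷ₑ σ) C (λ p → ⊆L (there p)) h'
      where
      M : Ty 0
      M = subst σ (μ C)
      unfolded : SuccIn L M
      unfolded = ≡-subst (_∈ L) (sym (unfold-subst σ C)) (⊆L (there (subterms-self (M ∷ₑ σ) C)))
      h' : ∀ i → SuccIn L ((M ∷ₑ σ) i)
      h' zero    = unfolded
      h' (suc i) = h i

    subterms-closed-children : ∀ {n} (σ : Fin n → Ty 0) A B {top} →
                               (∀ {x} → x ∈ top ∷ subterms σ A ++ subterms σ B → x ∈ L) →
                               (∀ i → SuccIn L (σ i)) → All (SuccIn L) (subterms σ A ++ subterms σ B)
    subterms-closed-children σ A B ⊆L h =
      ++⁺ (subterms-closed σ A (λ p → ⊆L (there (∈-++⁺ˡ p))) h)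
          (subterms-closed σ B (λ p → ⊆L (there (∈-++⁺ʳ (subterms σ A) p))) h)

module SuccClosed (L : List (Ty 0)) (closed : All (SuccIn L) L) where

  succ-in : ∀ {X} → X ∈ L → SuccIn L X
  succ-in = All.lookup closed

  flat-in : ∀ X → X ∈ L → All (_∈ L) (flat X)
  flat-in (var ()) p
  flat-in (con a) p = p ∷ []
  flat-in (A ＠ B) p = p ∷ []
  flat-in (A ⊃ B) p = p ∷ []
  flat-in (μ C)   p = p ∷ []
  flat-in (A ⊕ B) p = ++⁺ (flat-in A (proj₁ (succ-in p))) (flat-in B (proj₂ (succ-in p)))

  nfFuel-in : ∀ u X → X ∈ L → All (_∈ L) (nfFuel u X)
  nfFuel-in zero    X p = []
  nfFuel-in (suc u) (var ()) p
  nfFuel-in (suc u) (con a) p = p ∷ []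
  nfFuel-in (suc u) (A ＠ B) p = p ∷ []
  nfFuel-in (suc u) (A ⊃ B) p = p ∷ []
  nfFuel-in (suc u) (A ⊕ B) p =
    ++⁺ (nfFuel-in u A (proj₁ (succ-in p))) (nfFuel-in u B (proj₂ (succ-in p)))
  nfFuel-in (suc u) (μ C) p = nfFuel-in u (unfoldμ C) (succ-in p)

  nf-in : ∀ {X} → Contractive X → All (_∈ L) (flat X) → All (_∈ L) (nf X)
  nf-in {X} c fl = ≡-subst (All (_∈ L)) (sym (nf-flat c))
                     (concat⁺ (AllP.map⁺ (All.map (λ {x} → nfFuel-in (hw x) x) fl)))

closure : Ty 0 → Ty 0 → List (Ty 0)
closure A B = subterms (λ ()) A ++ subterms (λ ()) B

closure-closed : ∀ A B → All (SuccIn (closure A B)) (closure A B)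
closure-closed A B =
  ++⁺ (subterms-closed (closure A B) (λ ()) A ∈-++⁺ˡ (λ ()))
      (subterms-closed (closure A B) (λ ()) B (∈-++⁺ʳ (subterms (λ ()) A)) (λ ()))

subst-closed : ∀ (A : Ty 0) → subst (λ ()) A ≡ A
subst-closed A = trans (subst-cong (λ ()) A) (subst-var A)

left∈closure : ∀ A B → A ∈ closure A B
left∈closure A B = ∈-++⁺ˡ (≡-subst (_∈ subterms (λ ()) A) (subst-closed A) (subterms-self (λ ()) A))

right∈closure : ∀ A B → B ∈ closure A B
right∈closure A B =
  ∈-++⁺ʳ (subterms (λ ()) A) (≡-subst (_∈ subterms (λ ()) B) (subst-closed B) (subterms-self (λ ()) B))

module _ {A : Set} where

  count : {P : A → Set} → (∀ x → Dec (P x)) → List A → ℕ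
  count P? [] = 0
  count P? (x ∷ xs) with P? x
  ... | yes _ = suc (count P? xs)
  ... | no  _ = count P? xs

  count-mono : ∀ {P Q : A → Set} (P? : ∀ x → Dec (P x)) (Q? : ∀ x → Dec (Q x)) xs →
               (∀ {x} → x ∈ xs → Q x → P x) → count Q? xs ≤ count P? xs
  count-mono P? Q? [] Q⊆P = z≤n
  count-mono P? Q? (x ∷ xs) Q⊆P with Q? x | P? x
  ... | yes q | yes p = s≤s (count-mono P? Q? xs (λ m → Q⊆P (there m)))
  ... | yes q | no ¬p = ⊥-elim (¬p (Q⊆P (here refl) q))
  ... | no ¬q | yes p = ≤-trans (count-mono P? Q? xs (λ m → Q⊆P (there m))) (n≤1+n _)
  ... | no ¬q | no ¬p = count-mono P? Q? xs (λ m → Q⊆P (there m))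

  count-≡ : ∀ {P Q : A → Set} (P? : ∀ x → Dec (P x)) (Q? : ∀ x → Dec (Q x)) xs →
            (∀ {x} → x ∈ xs → Q x → P x) → count Q? xs ≡ count P? xs →
            ∀ {x} → x ∈ xs → P x → Q x
  count-≡ P? Q? (x ∷ xs) Q⊆P e m px with Q? x | P? x
  count-≡ P? Q? (x ∷ xs) Q⊆P e (here refl) px | yes q | yes p = q
  count-≡ P? Q? (x ∷ xs) Q⊆P e (there m) px | yes q | yes p =
    count-≡ P? Q? xs (λ m' → Q⊆P (there m')) (suc-injective e) m px
  ... | yes q | no ¬p = ⊥-elim (¬p (Q⊆P (here refl) q))
  ... | no ¬q | yes p =
    ⊥-elim (1+n≰n (≤-trans (≤-reflexive (sym e)) (count-mono P? Q? xs (λ m' → Q⊆P (there m')))))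
  count-≡ P? Q? (x ∷ xs) Q⊆P e (here refl) px | no ¬q | no ¬p = ⊥-elim (¬p px)
  count-≡ P? Q? (x ∷ xs) Q⊆P e (there m) px | no ¬q | no ¬p =
    count-≡ P? Q? xs (λ m' → Q⊆P (there m')) e m px

-- A decreasing sequence of decidable predicates becomes stationary on
-- any finite list: the counts decrease and cannot do so forever.
stationary : ∀ {A : Set} (P : ℕ → A → Set) → (∀ j x → Dec (P j x)) →
             (∀ j {x} → P (suc j) x → P j x) → ∀ xs →
             Σ ℕ λ J → ∀ {x} → x ∈ xs → P J x → P (suc J) x
stationary P P? decreasing xs = let (J , e) = search (cnt 0) 0 ≤-refl in
  J , count-≡ (P? J) (P? (suc J)) xs (λ _ → decreasing J) e
  where
  cnt : ℕ → ℕ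
  cnt j = count (P? j) xs
  cnt-down : ∀ j → cnt (suc j) ≤ cnt j
  cnt-down j = count-mono (P? j) (P? (suc j)) xs (λ _ → decreasing j)
  -- search for an index where the count does not drop, with n ≥ cnt j
  -- bounding the remaining number of drops
  search : ∀ n j → cnt j ≤ n → Σ ℕ λ J → cnt (suc J) ≡ cnt J
  search n j b with cnt (suc j) ≟ cnt j
  ... | yes e = j , e
  search zero    j b | no ne = ⊥-elim (ne (≤-antisym (cnt-down j) (≤-trans b z≤n)))
  search (suc n) j b | no ne = search n (suc j) (≤-pred (≤-trans (≤∧≢⇒< (cnt-down j) ne) b))

IsMu : Ty 0 → Set
IsMu x = Σ (Ty 1) λ C → x ≡ μ C

notMu-or-μ : ∀ x → NotMu x ⊎ IsMu x
notMu-or-μ (con a) = inj₁ tt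
notMu-or-μ (A ＠ B) = inj₁ tt
notMu-or-μ (A ⊃ B) = inj₁ tt
notMu-or-μ (A ⊕ B) = inj₁ tt
notMu-or-μ (μ C)   = inj₂ (C , refl)

data MuSplit (xs : List (Ty 0)) : Set where
  noMu    : All NotMu xs → MuSplit xs
  firstMu : ∀ pre C post → xs ≡ pre ++ μ C ∷ post → All NotMu pre → MuSplit xs

mu-split : ∀ xs → MuSplit xs
mu-split xs with First.first notMu-or-μ xs
... | inj₂ none = noMu none
... | inj₁ fst with toView fst
...   | First._++_∷_ nm (C , refl) post = firstMu _ C post refl nm

module Completeness (A B : Ty 0) where

  L : List (Ty 0)
  L = closure A B

  open SuccClosed L (closure-closed A B)

  stationary-on-L : Σ ℕ λ J → ∀ {x y} → x ∈ L → y ∈ L →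
                    AtomRel (Approx J) x y → AtomRel (Approx (suc J)) x y
  stationary-on-L =
    let (J , st) = stationary (λ j (x , y) → AtomRel (Approx j) x y) (λ j (x , y) → AtomRel? (Approx? j) x y)
                              (λ j → AtomRel-map (Approx-suc⇒Approx j)) (cartesianProduct L L)
    in J , λ x∈ y∈ → st (∈-cartesianProduct⁺ x∈ y∈)

  J : ℕ
  J = proj₁ stationary-on-L

  K : ℕ
  K = suc (suc J)

  record Related (X Y : Ty 0) : Set where
    field
      cX     : Contractive X
      cY     : Contractive Y
      flatX  : All (_∈ L) (flat X)
      flatY  : All (_∈ L) (flat Y)
      approx : Approx K X Y

  -- agreement at depth J + 1 lifts to depth K on types with components
  -- in L, since their atoms agreeing at depth J agree at depth J + 1
  Approx-stable : ∀ {D D'} → Contractive D → Contractive D' →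
                  All (_∈ L) (flat D) → All (_∈ L) (flat D') →
                  Approx (suc J) D D' → Approx K D D'
  Approx-stable cD cD' fD fD' =
    Sim-map-with (proj₂ stationary-on-L) (nf-in cD fD) (nf-in cD' fD')

  single-in : ∀ {x} → x ∈ L → NonUnion x → All (_∈ L) (flat x)
  single-in p nu = ≡-subst (All (_∈ L)) (sym (flat-nonUnion-single nu)) (p ∷ [])

  unfold-in : ∀ {X} pre C post → flat X ≡ pre ++ μ C ∷ post → All (_∈ L) (flat X) →
              All (_∈ L) (flat (plug pre (unfoldμ C) post))
  unfold-in {X} pre C post e fX =
    ≡-subst (All (_∈ L)) (sym (flat-plug pre (unfoldμ C) post))
      (concat⁺ (AllP.map⁺ (All-replace pre flats-in (flat-in _ (succ-in (All-hole pre inL))))))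
    where
    inL : All (_∈ L) (pre ++ μ C ∷ post)
    inL = ≡-subst (All (_∈ L)) e fX
    flats-in : All (λ x → All (_∈ L) (flat x)) (pre ++ μ C ∷ post)
    flats-in = All.zipWith (λ (p , nu) → single-in p nu) (inL , ≡-subst (All NonUnion) e (flat-nonUnion X))

  open Related

  subterm-related : ∀ {D D'} → Contractive D → Contractive D' → D ∈ L → D' ∈ L →
                    Approx (suc J) D D' → Related D D'
  subterm-related cD cD' p p' e = record
    { cX = cD ; cY = cD' ; flatX = flat-in _ p ; flatY = flat-in _ p'
    ; approx = Approx-stable cD cD' (flat-in _ p) (flat-in _ p') e }

  Component : Ty 0 → Set
  Component x = Contractive x × x ∈ L × Atom x

  components : ∀ {X} → Contractive X → All (_∈ L) (flat X) → All NotMu (flat X) → All Component (flat X)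
  components {X} c fX nm = All.zip (flat-contractive c ,
    All.zip (fX , All.zipWith (λ (m , u) → component-atom m u) (nm , flat-nonUnion X)))

  component-related : ∀ {x y} → Component x → Component y → AtomRel (Approx (suc J)) x y → Related x y
  component-related (cx , px , ax) (cy , py , ay) p = record
    { cX = cx ; cY = cy
    ; flatX = single-in px (atom-nonUnion ax) ; flatY = single-in py (atom-nonUnion ay)
    ; approx = subst₂ (Sim (AtomRel (Approx (suc J)))) (sym (nf-atom ax)) (sym (nf-atom ay)) (Sim-singleton p) }

  atom-step : ∀ {x y} → Component x → Component y → AtomRel (Approx (suc J)) x y → StepMu Related x y
  atom-step {con a} {con .a} _ _ refl = con
  atom-step {D ＠ A'} {D' ＠ A''} (app c d , p , _) (app c' d' , p' , _) (e , e') =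
    app (subterm-related c c' (proj₁ (succ-in p)) (proj₁ (succ-in p')) e)
        (subterm-related d d' (proj₂ (succ-in p)) (proj₂ (succ-in p')) e')
  atom-step {A' ⊃ B'} {A'' ⊃ B''} (fun c d , p , _) (fun c' d' , p' , _) (e , e') =
    fun (subterm-related c c' (proj₁ (succ-in p)) (proj₁ (succ-in p')) e)
        (subterm-related d d' (proj₂ (succ-in p)) (proj₂ (succ-in p')) e')

  noMu-step : ∀ {X Y} → Related X Y → All NotMu (flat X) → All NotMu (flat Y) → StepMu Related X Y
  noMu-step {X} {Y} r nmX nmY = by-shape (union-shape (flat X) (flat Y) (flat-nonEmpty X) (flat-nonEmpty Y))
    where
    compX : All Component (flat X)
    compX = components (cX r) (flatX r) nmX
    compY : All Component (flat Y)
    compY = components (cY r) (flatY r) nmY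
    similar : Sim (AtomRel (Approx (suc J))) (flat X) (flat Y)
    similar = subst₂ (Sim _) (nf-noμ (cX r) nmX) (nf-noμ (cY r) nmY) (approx r)
    by-shape : UnionShape (flat X) (flat Y) → StepMu Related X Y
    by-shape (union l) =
      let ((f , fR) , (g , gR)) = Sim⇒IndexSim (Sim-map-with component-related compX compY similar)
      in uni l nmX nmY f fR g gR
    by-shape (singletons eX eY) =
      subst₂ (StepMu Related) (sym (flat-singleton X eX)) (sym (flat-singleton Y eY))
        (atom-step (All.head (≡-subst (All Component) eX compX)) (All.head (≡-subst (All Component) eY compY))
                   (Sim-singleton⁻ (subst₂ (Sim _) eX eY similar)))

  related-step : ∀ {X Y} → Related X Y → StepMu Related X Y
  related-step {X} {Y} r with mu-split (flat X)
  ... | firstMu pre C post e nm = μL pre C post e nm (record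
    { cX = contractive-X' ; cY = cY r ; flatX = unfold-in {X} pre C post e (flatX r) ; flatY = flatY r
    ; approx = ≡-subst (λ z → Sim _ z (nf Y)) (sym nf-X') (approx r) })
    where open UnfoldComponent pre C post (cX r) e
  ... | noMu nmX with mu-split (flat Y)
  ...   | firstMu pre C post e nm = μR pre C post nmX e nm (record
    { cX = cX r ; cY = contractive-X' ; flatX = flatX r ; flatY = unfold-in {Y} pre C post e (flatY r)
    ; approx = ≡-subst (λ z → Sim _ (nf X) z) (sym nf-X') (approx r) })
    where open UnfoldComponent pre C post (cY r) e
  ...   | noMu nmY = noMu-step r nmX nmY

  related-roots : Contractive A → Contractive B → Approx K A B → Related A B
  related-roots cA cB e = record
    { cX = cA ; cY = cB ; flatX = flat-in A (left∈closure A B) ; flatY = flat-in B (right∈closure A B)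
    ; approx = e }

lemma4 : (A B : Ty 0) → Contractive A → Contractive B →
    (A ≃μ B) ⇔ (∀ (k : ℕ) → ∃₂ λ t u → (T A ∣ k ↦ t) × (T B ∣ k ↦ u) × (t ≃𝔗 u))
lemma4 A B cA cB = mk⇔ sound complete
  where
  open Completeness A B
  sound : A ≃μ B → ∀ (k : ℕ) → ∃₂ λ t u → (T A ∣ k ↦ t) × (T B ∣ k ↦ u) × (t ≃𝔗 u)
  sound (R , r , step) k =
    trunc k A , trunc k B , trunc-T k cA , trunc-T k cB , Approx⇒≃𝔗 k cA cB (bisim⇒Approx step k cA cB r)
  complete : (∀ (k : ℕ) → ∃₂ λ t u → (T A ∣ k ↦ t) × (T B ∣ k ↦ u) × (t ≃𝔗 u)) → A ≃μ B
  complete h =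
    let (_ , _ , tA , tB , (R , r , step)) = h K
        truncs-related = subst₂ R (↦-functional tA (trunc-T K cA)) (↦-functional tB (trunc-T K cB)) r
    in Related , related-roots cA cB (tree-bisim⇒Approx step K cA cB truncs-related) , related-step
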